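{- There is an absolute constant $c>0$ such that the following holds. Let $\Gamma$ be a nonempty finite set, $A\subseteq\Gamma$, and $\mathcal B\subseteq\mathcal P(\Gamma)$ non-empty. If $D_\cap(A\mid\mathcal B)=t$ (finite), then $D_\cup(A\mid\mathcal B)\le D(A\mid\mathcal B)\le c\,(t+|\mathcal B|)^3$.
   Context: A sequence $A_1,\dots,A_s$ ($s\ge1$) of subsets of $\Gamma$ generates $A$ from $\mathcal B$ if $A_s=A$ and each $A_i$ equals $X\cup Y$ or $X\cap Y$ for some (not necessarily distinct) $X,Y\in\mathcal B\cup\{A_1,\dots,A_{i-1}\}$. $D(A\mid\mathcal B)$ is the minimum length of such a sequence ($\infty$ if none); $D_\cap(A\mid\mathcal B)$ (resp. $D_\cup(A\mid\mathcal B)$) is the minimum number of intersection (resp. union) steps over all sequences generating $A$ from $\mathcal B$. -}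

module Defs where

open import Data.Nat using (ℕ; zero; suc; _+_; _≤_)
open import Data.Fin.Subset using (Subset; _∪_; _∩_)
open import Data.List using (List; []; _∷_; length)
open import Data.List.Membership.Propositional using (_∈_)
open import Data.Maybe using (Maybe; just; nothing)
open import Data.Product using (_×_; _,_; Σ; ∃)
open import Data.Unit using (⊤)
open import Relation.Binary.PropositionalEquality using (_≡_)

-- The ground set Γ is Fin n; subsets of Γ are Data.Fin.Subset n.

data Op : Set where
  ∪op ∩op : Op

apply : ∀ {n} → Op → Subset n → Subset n → Subset n
apply ∪op X Y = X ∪ Y
apply ∩op X Y = X ∩ Y

record Step (n : ℕ) : Set where
  constructor step
  field
    op  : Op
    lhs : Subset n
    rhs : Subset n

result : ∀ {n} → Step n → Subset n
result (step o X Y) = apply o X Y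

-- Validity: each operand lies in 𝓑 ∪ {A_1, …, A_{i-1}} (the list 'avail').
Valid : ∀ {n} → List (Subset n) → List (Step n) → Set
Valid avail [] = ⊤
Valid avail (s ∷ ss) = (Step.lhs s ∈ avail) × (Step.rhs s ∈ avail) × Valid (result s ∷ avail) ss

lastResult : ∀ {n} → List (Step n) → Maybe (Subset n)
lastResult [] = nothing
lastResult (s ∷ []) = just (result s)
lastResult (s ∷ t ∷ ss) = lastResult (t ∷ ss)

Generates : ∀ {n} → List (Subset n) → List (Step n) → Subset n → Set
Generates 𝓑 ss A = Valid 𝓑 ss × lastResult ss ≡ just A

count : ∀ {n} → Op → List (Step n) → ℕ
count o [] = 0
count ∪op (step ∪op _ _ ∷ ss) = suc (count ∪op ss)
count ∪op (step ∩op _ _ ∷ ss) = count ∪op ss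
count ∩op (step ∩op _ _ ∷ ss) = suc (count ∩op ss)
count ∩op (step ∪op _ _ ∷ ss) = count ∩op ss

-- "cost 𝓑 A = m": m is the minimum of cost over sequences generating A from 𝓑
-- (in particular it is finite).
IsMin : ∀ {n} → (List (Step n) → ℕ) → List (Subset n) → Subset n → ℕ → Set
IsMin cost 𝓑 A m =
  (Σ _ λ ss → Generates 𝓑 ss A × cost ss ≡ m) ×
  (∀ ss → Generates 𝓑 ss A → m ≤ cost ss)

D≡ : ∀ {n} → List (Subset n) → Subset n → ℕ → Set
D≡ = IsMin length

D∩≡ : ∀ {n} → List (Subset n) → Subset n → ℕ → Set
D∩≡ = IsMin (count ∩op)

D∪≡ : ∀ {n} → List (Subset n) → Subset n → ℕ → Set
D∪≡ = IsMin (count ∪op)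

{-# OPTIONS --safe #-}
module Submission where

-- Replay a generating sequence keeping as "atoms" the sets of 𝓑 together with the results of
-- the intersection steps replayed so far.  Every set of the original sequence is then the union
-- of a nonempty sublist of the atoms (unions of such unions are again such, by idempotence and
-- commutativity), and such a union is rebuilt with at most as many union steps as there are
-- atoms.  There are N = t + |𝓑| atoms in the end, so each intersection step is replayed with
-- at most 2N + 1 steps and the target with N more: D ≤ t(2N + 1) + N ≤ 4N³.  The same replay
-- with ∪ and ∩ exchanged bounds the length of a sequence in terms of its number of union steps,
-- so for each cost there are finitely many candidate sequences and the minima D and D_∪ exist
-- by exhaustive search; D_∪ ≤ D since a sequence has at most as many union steps as steps.

open import Defs
open import Algebra.Bundles using (CommutativeSemigroup)
open import Algebra.Core using (Op₂)
open import Algebra.Lattice.Structures using (IsSemilattice)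
import Algebra.Properties.CommutativeSemigroup as CommutativeSemigroupProperties
open import Data.Bool.Properties using () renaming (_≟_ to _≟ᵇ_)
open import Data.Empty using (⊥-elim)
open import Data.Fin.Subset using (Subset)
open import Data.Fin.Subset.Properties using (∪-isSemilattice; ∩-isSemilattice)
open import Data.List
  using (List; []; _∷_; [_]; _++_; _∷ʳ_; length; map; concatMap; cartesianProduct)
open import Data.List.Membership.Propositional using (_∈_; lose)
open import Data.List.Membership.Propositional.Properties
  using (∈-map⁺; ∈-concatMap⁺; ∈-cartesianProduct⁺)
open import Data.List.Properties using (length-++)
open import Data.List.Relation.Binary.Subset.Propositional using (_⊆_)
open import Data.List.Relation.Unary.Any using (here; there; any?; satisfied)
open import Data.List.Relation.Unary.Unique.Propositional using (Unique)
open import Data.Maybe using (just)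
import Data.Maybe.Properties as Maybe
open import Data.Nat using (ℕ; zero; suc; _+_; _*_; _^_; _≤_; _<_; z≤n; s≤s; _≤?_)
open import Data.Nat.Induction using (<-rec)
open import Data.Nat.Properties
  using ( anyUpTo?; ≮⇒≥; n≤1+n; m≤n⇒m≤1+n; m≤m+n; m≤n+m
        ; ≤-refl; ≤-reflexive; ≤-trans; ≤-antisym
        ; +-comm; +-suc; +-identityʳ; *-identityʳ; *-distribʳ-+
        ; +-mono-≤; +-monoˡ-≤; *-monoˡ-≤; *-monoʳ-≤; ^-monoʳ-≤; module ≤-Reasoning )
open import Data.Nat.Tactic.RingSolver using (solve-∀)
open import Data.Product using (Σ; ∃; _×_; _,_; proj₁; proj₂)
open import Data.Unit using (tt)
open import Data.Vec.Properties using (≡-dec)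
open import Function using (_∘_; id)
open import Relation.Nullary using (Dec; yes; no)
open import Relation.Nullary.Decidable using (_×-dec_)
open import Relation.Binary.PropositionalEquality
  using (_≡_; _≢_; refl; sym; trans; cong; cong₂; subst)

module SublistJoin {a} {A : Set a} {_∙_ : Op₂ A} (isSemilattice : IsSemilattice _≡_ _∙_)
  where

  open IsSemilattice _≡_ isSemilattice using (isSemigroup; assoc; comm; idem)

  ∙-commutativeSemigroup : CommutativeSemigroup a a
  ∙-commutativeSemigroup = record
    { isCommutativeSemigroup = record { isSemigroup = isSemigroup ; comm = comm } }

  open CommutativeSemigroupProperties ∙-commutativeSemigroup
    using (interchange; x∙yz≈y∙xz; xy∙z≈z∙xy)

  data Join : List A → A → Set a where
    skip  : ∀ {L x y} → Join L x → Join (y ∷ L) x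
    this  : ∀ {L y} → Join (y ∷ L) y
    this∙ : ∀ {L x y} → Join L x → Join (y ∷ L) (y ∙ x)

  x∙xy≡x∙y : ∀ x y → x ∙ (x ∙ y) ≡ x ∙ y
  x∙xy≡x∙y x y = trans (sym (assoc x x y)) (cong (_∙ y) (idem x))

  join-∙ : ∀ {L x y} → Join L x → Join L y → Join L (x ∙ y)
  join-∙ (skip p) (skip q) = skip (join-∙ p q)
  join-∙ (skip {x = x} {y = y} p) this = subst (Join _) (comm y x) (this∙ p)
  join-∙ (skip {x = x} {y = y} p) (this∙ {x = z} q) =
    subst (Join _) (x∙yz≈y∙xz y x z) (this∙ (join-∙ p q))
  join-∙ this (skip q) = this∙ q
  join-∙ (this {y = y}) this = subst (Join _) (sym (idem y)) this
  join-∙ (this {y = y}) (this∙ {x = z} q) =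
    subst (Join _) (sym (x∙xy≡x∙y y z)) (this∙ q)
  join-∙ (this∙ {x = x} {y = y} p) (skip {x = z} q) =
    subst (Join _) (sym (assoc y x z)) (this∙ (join-∙ p q))
  join-∙ (this∙ {x = x} {y = y} p) this =
    subst (Join _) (trans (sym (x∙xy≡x∙y y x)) (sym (xy∙z≈z∙xy y x y))) (this∙ p)
  join-∙ (this∙ {x = x} {y = y} p) (this∙ {x = z} q) =
    subst (Join _) (trans (cong (_∙ (x ∙ z)) (sym (idem y))) (sym (interchange y x y z)))
      (this∙ (join-∙ p q))

  ∈⇒Join : ∀ {L x} → x ∈ L → Join L x
  ∈⇒Join (here refl) = this
  ∈⇒Join (there p)   = skip (∈⇒Join p)

least-satisfying : ∀ {p} {P : ℕ → Set p} → (∀ m → Dec (P m)) →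
  ∀ k → P k → ∃ λ m → P m × (∀ j → P j → m ≤ j)
least-satisfying {P = P} P? = <-rec (λ k → P k → Least) search
  where
  Least = ∃ λ m → P m × (∀ j → P j → m ≤ j)

  search : ∀ k → (∀ {j} → j < k → P j → Least) → P k → Least
  search k below pk with anyUpTo? P? k
  ... | yes (j , j<k , pj) = below j<k pj
  ... | no none = k , pk , λ j pj → ≮⇒≥ (λ j<k → none (j , j<k , pj))

length-∷ʳ : ∀ {a} {A : Set a} (xs : List A) {x} → length (xs ∷ʳ x) ≡ suc (length xs)
length-∷ʳ xs = trans (length-++ xs) (+-comm (length xs) 1)

-- k replayed dual steps, each costing two joins of at most N atoms plus the step itself,
-- followed by one join of all N = b + k atoms giving the target.
lengthBound : ℕ → ℕ → ℕ
lengthBound b k = k * (N + suc N) + N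
  where N = b + k

lengthBound≤cube : ∀ b k → 0 < b → lengthBound b k ≤ 4 * (k + b) ^ 3
lengthBound≤cube b@(suc _) k _ = begin
  k * (N + suc N) + N        ≤⟨ +-monoˡ-≤ N (*-monoˡ-≤ (N + suc N) (m≤n+m k b)) ⟩
  N * (N + suc N) + N        ≡⟨ expand N ⟩
  2 * (N * N) + 2 * N        ≤⟨ +-mono-≤ (*-monoʳ-≤ 2 N²≤N³) (*-monoʳ-≤ 2 N≤N³) ⟩
  2 * N ^ 3 + 2 * N ^ 3      ≡⟨ *-distribʳ-+ (N ^ 3) 2 2 ⟨
  4 * N ^ 3                  ≡⟨ cong (λ M → 4 * M ^ 3) (+-comm b k) ⟩
  4 * (k + b) ^ 3            ∎
  where
  open ≤-Reasoning
  N = b + k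
  expand : ∀ m → m * (m + suc m) + m ≡ 2 * (m * m) + 2 * m
  expand = solve-∀
  N²≤N³ : N * N ≤ N ^ 3
  N²≤N³ = subst (_≤ N ^ 3) (cong (N *_) (*-identityʳ N)) (^-monoʳ-≤ N {2} {3} (n≤1+n 2))
  N≤N³ : N ≤ N ^ 3
  N≤N³ = subst (_≤ N ^ 3) (*-identityʳ N) (^-monoʳ-≤ N {1} {3} (s≤s z≤n))

dual : Op → Op
dual ∪op = ∩op
dual ∩op = ∪op

data SameOrDual (o : Op) : Op → Set where
  same  : SameOrDual o o
  other : SameOrDual o (dual o)

sameOrDual : ∀ o p → SameOrDual o p
sameOrDual ∪op ∪op = same
sameOrDual ∪op ∩op = other
sameOrDual ∩op ∪op = other
sameOrDual ∩op ∩op = same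

module _ {n : ℕ} where

  apply-isSemilattice : ∀ o → IsSemilattice _≡_ (apply {n} o)
  apply-isSemilattice ∪op = ∪-isSemilattice n
  apply-isSemilattice ∩op = ∩-isSemilattice n

  open module Joins (o : Op) = SublistJoin (apply-isSemilattice o)
    using (Join; skip; this; this∙; join-∙; ∈⇒Join)

  count-self : ∀ o X Y (ss : List (Step n)) → count o (step o X Y ∷ ss) ≡ suc (count o ss)
  count-self ∪op X Y ss = refl
  count-self ∩op X Y ss = refl

  count-dual : ∀ o X Y (ss : List (Step n)) →
    count (dual o) (step o X Y ∷ ss) ≡ count (dual o) ss
  count-dual ∪op X Y ss = refl
  count-dual ∩op X Y ss = refl

  count-++ : ∀ o (ss ts : List (Step n)) → count o (ss ++ ts) ≡ count o ss + count o ts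
  count-++ o [] ts = refl
  count-++ ∪op (step ∪op _ _ ∷ ss) ts = cong suc (count-++ ∪op ss ts)
  count-++ ∪op (step ∩op _ _ ∷ ss) ts = count-++ ∪op ss ts
  count-++ ∩op (step ∩op _ _ ∷ ss) ts = cong suc (count-++ ∩op ss ts)
  count-++ ∩op (step ∪op _ _ ∷ ss) ts = count-++ ∩op ss ts

  count≤length : ∀ o (ss : List (Step n)) → count o ss ≤ length ss
  count≤length o [] = z≤n
  count≤length ∪op (step ∪op _ _ ∷ ss) = s≤s (count≤length ∪op ss)
  count≤length ∪op (step ∩op _ _ ∷ ss) = m≤n⇒m≤1+n (count≤length ∪op ss)
  count≤length ∩op (step ∩op _ _ ∷ ss) = s≤s (count≤length ∩op ss)
  count≤length ∩op (step ∪op _ _ ∷ ss) = m≤n⇒m≤1+n (count≤length ∩op ss)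

  availableAfter : List (Subset n) → List (Step n) → List (Subset n)
  availableAfter avail [] = avail
  availableAfter avail (s ∷ ss) = availableAfter (result s ∷ avail) ss

  availableAfter-++ : ∀ avail (ss ts : List (Step n)) →
    availableAfter avail (ss ++ ts) ≡ availableAfter (availableAfter avail ss) ts
  availableAfter-++ avail [] ts = refl
  availableAfter-++ avail (s ∷ ss) ts = availableAfter-++ (result s ∷ avail) ss ts

  ⊆-availableAfter : ∀ avail ss → avail ⊆ availableAfter avail ss
  ⊆-availableAfter avail [] p = p
  ⊆-availableAfter avail (s ∷ ss) p = ⊆-availableAfter (result s ∷ avail) ss (there p)

  lastResult∈availableAfter : ∀ avail ss {X} →
    lastResult ss ≡ just X → X ∈ availableAfter avail ss
  lastResult∈availableAfter avail (s ∷ []) refl = here refl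
  lastResult∈availableAfter avail (s ∷ t ∷ ss) last =
    lastResult∈availableAfter (result s ∷ avail) (t ∷ ss) last

  generated∈availableAfter : ∀ {avail ss X} →
    Generates avail ss X → X ∈ availableAfter avail ss
  generated∈availableAfter {avail} {ss} (_ , last) = lastResult∈availableAfter avail ss last

  valid-++ : ∀ avail (ss ts : List (Step n)) →
    Valid avail ss → Valid (availableAfter avail ss) ts → Valid avail (ss ++ ts)
  valid-++ avail [] ts _ v = v
  valid-++ avail (s ∷ ss) ts (l , r , v) w = l , r , valid-++ (result s ∷ avail) ss ts v w

  lastResult-++ : ∀ (ss ts : List (Step n)) {X} →
    lastResult ts ≡ just X → lastResult (ss ++ ts) ≡ just X
  lastResult-++ [] ts last = last
  lastResult-++ (s ∷ []) (t ∷ ts) last = last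
  lastResult-++ (s ∷ s′ ∷ ss) (t ∷ ts) last = lastResult-++ (s′ ∷ ss) (t ∷ ts) last

  generates-++ : ∀ {avail} ss {ts X} →
    Valid avail ss → Generates (availableAfter avail ss) ts X → Generates avail (ss ++ ts) X
  generates-++ {avail} ss {ts} v (w , last) = valid-++ avail ss ts v w , lastResult-++ ss ts last

  generateJoin : ∀ {o atoms avail X} → Join o atoms X → atoms ⊆ avail →
    ∃ λ ss → Generates avail ss X × length ss ≤ length atoms × count (dual o) ss ≡ 0
  generateJoin (skip p) atoms⊆ with generateJoin p (atoms⊆ ∘ there)
  ... | ss , gen , len , cnt = ss , gen , m≤n⇒m≤1+n len , cnt
  -- a generating sequence has at least one step, so an atom y is produced as y ∙ y
  generateJoin {o} (this {y = y}) atoms⊆ =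
    [ step o y y ] ,
    ((atoms⊆ (here refl) , atoms⊆ (here refl) , tt) ,
     cong just (IsSemilattice.idem _≡_ (apply-isSemilattice o) y)) ,
    s≤s z≤n , count-dual o y y []
  generateJoin {o} {avail = avail} (this∙ {x = x} {y = y} p) atoms⊆
    with generateJoin p (atoms⊆ ∘ there)
  ... | ss , gen , len , cnt =
    ss ∷ʳ step o y x ,
    generates-++ ss (proj₁ gen)
      ((⊆-availableAfter avail ss (atoms⊆ (here refl)) , generated∈availableAfter gen , tt) , refl) ,
    subst (_≤ suc _) (sym (length-∷ʳ ss)) (s≤s len) ,
    trans (count-++ (dual o) ss _) (cong₂ _+_ cnt (count-dual o y x []))

  -- old and new are the sets available in the original and in the replayed sequence; every
  -- old set is an o-join of atoms, which are available in the replay.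
  record Simulation (o : Op) (old atoms new : List (Subset n)) : Set where
    field
      represent : ∀ {X} → X ∈ old → Join o atoms X
      atoms⊆new : atoms ⊆ new

  open Simulation

  initialSimulation : ∀ o avail → Simulation o avail avail avail
  initialSimulation o avail .represent = ∈⇒Join o
  initialSimulation o avail .atoms⊆new p = p

  simulation-same : ∀ {o old atoms new X Y} → Simulation o old atoms new → X ∈ old → Y ∈ old →
    Simulation o (apply o X Y ∷ old) atoms new
  simulation-same {o} sim x∈ y∈ .represent (here refl) =
    join-∙ o (sim .represent x∈) (sim .represent y∈)
  simulation-same sim x∈ y∈ .represent (there p) = sim .represent p
  simulation-same sim x∈ y∈ .atoms⊆new = sim .atoms⊆new

  record DualStepReplay (o : Op) (atoms new : List (Subset n)) (I : Subset n) : Set where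
    field
      prefix        : List (Step n)
      generates     : Generates new prefix I
      prefix-length : length prefix ≤ length atoms + suc (length atoms)
      prefix-count  : count (dual o) prefix ≡ 1

  replayDualStep : ∀ {o old atoms new X Y} → Simulation o old atoms new → X ∈ old → Y ∈ old →
    DualStepReplay o atoms new (apply (dual o) X Y)
  replayDualStep {o} {new = new} {X} {Y} sim x∈ y∈
    with generateJoin (sim .represent x∈) (sim .atoms⊆new)
  ... | ssX , genX , lenX , cntX
    with generateJoin (sim .represent y∈) (⊆-availableAfter new ssX ∘ sim .atoms⊆new)
  ... | ssY , genY , lenY , cntY = record
    { prefix = ssX ++ ssY ∷ʳ step (dual o) X Y
    ; generates = generates-++ ssX (proj₁ genX) (generates-++ ssY (proj₁ genY)
        ((⊆-availableAfter _ ssY (generated∈availableAfter genX) ,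
          generated∈availableAfter genY , tt) , refl))
    ; prefix-length =
        subst (_≤ _) (sym (trans (length-++ ssX) (cong (length ssX +_) (length-∷ʳ ssY))))
          (+-mono-≤ lenX (s≤s lenY))
    ; prefix-count =
        trans (count-++ (dual o) ssX _)
          (cong₂ _+_ cntX (trans (count-++ (dual o) ssY _)
                                 (cong₂ _+_ cntY (count-self (dual o) X Y []))))
    }

  open DualStepReplay

  simulation-dual : ∀ {o old atoms new I} →
    Simulation o old atoms new → (d : DualStepReplay o atoms new I) →
    Simulation o (I ∷ old) (I ∷ atoms) (availableAfter new (d .prefix))
  simulation-dual {o} sim d .represent (here refl) = this {o = o}
  simulation-dual {o} sim d .represent (there p) = skip {o = o} (sim .represent p)
  simulation-dual sim d .atoms⊆new (here refl) = generated∈availableAfter (d .generates)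
  simulation-dual {new = new} sim d .atoms⊆new (there p) =
    ⊆-availableAfter new (d .prefix) (sim .atoms⊆new p)

  record Simulated (o : Op) (old′ : List (Subset n)) (k : ℕ) (atoms new : List (Subset n))
         : Set where
    field
      steps         : List (Step n)
      atoms′        : List (Subset n)
      valid         : Valid new steps
      simulation    : Simulation o old′ atoms′ (availableAfter new steps)
      atoms′-length : length atoms′ ≡ length atoms + k
      steps-length  : length steps ≤ k * (length atoms′ + suc (length atoms′))
      steps-count   : count (dual o) steps ≡ k

  open Simulated

  prependReplay : ∀ {o old′ k atoms new I} (d : DualStepReplay o atoms new I) →
    Simulated o old′ k (I ∷ atoms) (availableAfter new (d .prefix)) →
    Simulated o old′ (suc k) atoms new
  prependReplay {o} {old′} {k} {atoms} {new} d R = record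
    { steps         = d .prefix ++ R.steps
    ; atoms′        = R.atoms′
    ; valid         = valid-++ new (d .prefix) R.steps (proj₁ (d .generates)) R.valid
    ; simulation    = subst (Simulation o old′ R.atoms′)
                        (sym (availableAfter-++ new (d .prefix) R.steps)) R.simulation
    ; atoms′-length = trans R.atoms′-length (sym (+-suc (length atoms) k))
    ; steps-length  = subst (_≤ _) (sym (length-++ (d .prefix)))
                        (+-mono-≤ (≤-trans (d .prefix-length) (+-mono-≤ atoms≤ (s≤s atoms≤)))
                                  R.steps-length)
    ; steps-count   = trans (count-++ (dual o) (d .prefix) R.steps)
                        (cong₂ _+_ (d .prefix-count) R.steps-count)
    }
    where
    module R = Simulated R
    atoms≤ : length atoms ≤ length R.atoms′
    atoms≤ = subst (length atoms ≤_) (sym R.atoms′-length) (≤-trans (n≤1+n _) (m≤m+n _ k))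

  simulate : ∀ o {old atoms new} os → Valid old os → Simulation o old atoms new →
    Simulated o (availableAfter old os) (count (dual o) os) atoms new
  simulate o {atoms = atoms} [] _ sim = record
    { steps = [] ; atoms′ = atoms ; valid = tt ; simulation = sim
    ; atoms′-length = sym (+-identityʳ _) ; steps-length = z≤n ; steps-count = refl }
  simulate o {old} {atoms} {new} (step p X Y ∷ os) (x∈ , y∈ , v) sim with sameOrDual o p
  ... | same  = subst (λ k → Simulated o (availableAfter (apply o X Y ∷ old) os) k atoms new)
                  (sym (count-dual o X Y os))
                  (simulate o os v (simulation-same sim x∈ y∈))
  ... | other rewrite count-self (dual o) X Y os =
    let d = replayDualStep sim x∈ y∈ in prependReplay d (simulate o os v (simulation-dual sim d))

  shortGenerator : ∀ o {B A} ss → Generates B ss A →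
    ∃ λ ss′ → Generates B ss′ A × count (dual o) ss′ ≤ count (dual o) ss ×
              length ss′ ≤ lengthBound (length B) (count (dual o) ss)
  shortGenerator o {B} ss gen with simulate o ss (proj₁ gen) (initialSimulation o B)
  ... | R with generateJoin (R .simulation .represent (generated∈availableAfter gen))
                            (R .simulation .atoms⊆new)
  ... | final , genA , len , cnt =
    R .steps ++ final ,
    generates-++ (R .steps) (R .valid) genA ,
    ≤-reflexive (trans (count-++ (dual o) (R .steps) final)
                       (trans (cong (_ +_) cnt) (trans (+-identityʳ _) (R .steps-count)))) ,
    subst (λ N → length (R .steps ++ final) ≤ count (dual o) ss * (N + suc N) + N)
      (R .atoms′-length)
      (subst (_≤ _) (sym (length-++ (R .steps))) (+-mono-≤ (R .steps-length) len))

  allSteps : List (Subset n) → List (Step n)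
  allSteps avail = map (λ (o , X , Y) → step o X Y)
    (cartesianProduct (∪op ∷ ∩op ∷ []) (cartesianProduct avail avail))

  ∈-allSteps : ∀ {avail} o {X Y} → X ∈ avail → Y ∈ avail → step o X Y ∈ allSteps avail
  ∈-allSteps o x∈ y∈ = ∈-map⁺ _ (∈-cartesianProduct⁺ (op∈ o) (∈-cartesianProduct⁺ x∈ y∈))
    where
    op∈ : ∀ o → o ∈ ∪op ∷ ∩op ∷ []
    op∈ ∪op = here refl
    op∈ ∩op = there (here refl)

  sequences : List (Subset n) → ℕ → List (List (Step n))
  sequences avail zero = [ [] ]
  sequences avail (suc k) =
    [] ∷ concatMap (λ s → map (s ∷_) (sequences (result s ∷ avail) k)) (allSteps avail)

  ∈-sequences : ∀ avail k ss → Valid avail ss → length ss ≤ k → ss ∈ sequences avail k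
  ∈-sequences avail zero [] _ _ = here refl
  ∈-sequences avail (suc k) [] _ _ = here refl
  ∈-sequences avail (suc k) (step o X Y ∷ ss) (x∈ , y∈ , v) (s≤s len) =
    there (∈-concatMap⁺ _ (lose (∈-allSteps o x∈ y∈) (∈-map⁺ _ (∈-sequences _ k ss v len))))

  valid? : ∀ avail (ss : List (Step n)) → Dec (Valid avail ss)
  valid? avail [] = yes tt
  valid? avail (step o X Y ∷ ss) =
    (X ∈? avail) ×-dec (Y ∈? avail) ×-dec valid? (apply o X Y ∷ avail) ss
    where open import Data.List.Membership.DecPropositional (≡-dec _≟ᵇ_) using (_∈?_)

  generates? : ∀ B ss (A : Subset n) → Dec (Generates B ss A)
  generates? B ss A = valid? B ss ×-dec Maybe.≡-dec (≡-dec _≟ᵇ_) (lastResult ss) (just A)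

  minimumExists : ∀ (cost : List (Step n) → ℕ) (bound : ℕ → ℕ) {B A} →
    (∀ ss → Generates B ss A →
       ∃ λ ss′ → Generates B ss′ A × cost ss′ ≤ cost ss × length ss′ ≤ bound (cost ss)) →
    ∀ ss → Generates B ss A → ∃ (IsMin cost B A)
  minimumExists cost bound {B} {A} shorten ss gen
    with least-satisfying Short? (cost ss) (shorten ss gen)
    where
    Short : ℕ → Set
    Short m = ∃ λ ss → Generates B ss A × cost ss ≤ m × length ss ≤ bound m

    Short? : ∀ m → Dec (Short m)
    Short? m with any? (λ ss → generates? B ss A ×-dec cost ss ≤? m ×-dec length ss ≤? bound m)
                       (sequences B (bound m))
    ... | yes found = yes (satisfied found)
    ... | no none   = no λ (ss , gen , c≤ , len) →
                        none (lose (∈-sequences B (bound m) ss (proj₁ gen) len) (gen , c≤ , len))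
  ... | m , (ssₘ , genₘ , c≤m , _) , least =
    m , (ssₘ , genₘ , ≤-antisym c≤m (least _ (shorten ssₘ genₘ))) ,
    λ ss gen → least _ (shorten ss gen)

corollary3p8 : Σ ℕ λ c → 0 < c ×
    (∀ (n : ℕ) → 0 < n → (A : Subset n) → (𝓑 : List (Subset n)) → Unique 𝓑 → 𝓑 ≢ [] →
      (t : ℕ) → D∩≡ 𝓑 A t →
      Σ ℕ λ d → D≡ 𝓑 A d × (Σ ℕ λ u → D∪≡ 𝓑 A u × u ≤ d) ×
        d ≤ c * (t + length 𝓑) ^ 3)
-- Neither 0 < n nor the uniqueness of the entries of 𝓑 is needed.
corollary3p8 = 4 , s≤s z≤n , λ n _ A 𝓑 _ 𝓑≢[] t → bounds (length>0 𝓑≢[])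
  where
  length>0 : ∀ {n} {𝓑 : List (Subset n)} → 𝓑 ≢ [] → 0 < length 𝓑
  length>0 {𝓑 = []} 𝓑≢[] = ⊥-elim (𝓑≢[] refl)
  length>0 {𝓑 = _ ∷ _} _ = s≤s z≤n

  bounds : ∀ {n} {A : Subset n} {𝓑 t} → 0 < length 𝓑 → D∩≡ 𝓑 A t →
    Σ ℕ λ d → D≡ 𝓑 A d × (Σ ℕ λ u → D∪≡ 𝓑 A u × u ≤ d) × d ≤ 4 * (t + length 𝓑) ^ 3
  bounds {𝓑 = 𝓑} 𝓑>0 ((ss , gen , refl) , _)
    with minimumExists length id (λ ss gen → ss , gen , ≤-refl , ≤-refl) ss gen
       | minimumExists (count ∪op) (lengthBound (length 𝓑)) (shortGenerator ∩op) ss gen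
       | shortGenerator ∪op ss gen
  ... | d , D@((ssD , genD , lengthD) , _) | u , U | ss₁ , gen₁ , _ , length₁ =
    d , D ,
    (u , U , ≤-trans (proj₂ U ssD genD) (≤-trans (count≤length ∪op ssD) (≤-reflexive lengthD))) ,
    ≤-trans (proj₂ D ss₁ gen₁)
      (≤-trans length₁ (lengthBound≤cube (length 𝓑) (count ∩op ss) 𝓑>0))
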